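{- Let $(r)$ be a rule of $\mathsf{G3K_t}$ other than the initial rules. For every instance of $(r)$, all its premises are labeled polytree sequents if and only if its conclusion is a labeled polytree sequent.
   Context: Formulae: $A ::= p \mid \top \mid \bot \mid \neg A \mid (A\lor A)\mid (A\land A)\mid (A\to A)\mid \mathsf{G}A\mid \mathsf{F}A\mid \mathsf{H}A\mid \mathsf{P}A$. A labeled sequent is $\mathcal R,\Gamma\Rightarrow\Delta$ with $\mathcal R$ a finite set of relational atoms $Rwu$ and $\Gamma,\Delta$ finite multisets of labeled formulae $w:A$ ($w,u$ labels). $\mathsf{G3K_t}$ has initial rules $\mathcal R,\Gamma,w:p\Rightarrow w:p,\Delta$; $\mathcal R,\Gamma,w:\bot\Rightarrow\Delta$; $\mathcal R,\Gamma\Rightarrow w:\top,\Delta$, and non-initial rules (premise(s)/conclusion, arbitrary $\mathcal R,\Gamma,\Delta$): $\mathcal R,\Gamma\Rightarrow w:A,\Delta/\mathcal R,\Gamma,w:\neg A\Rightarrow\Delta$; $\mathcal R,\Gamma,w:A\Rightarrow\Delta/\mathcal R,\Gamma\Rightarrow w:\neg A,\Delta$; $\mathcal R,\Gamma,w:A,w:B\Rightarrow\Delta/\mathcal R,\Gamma,w:A\land B\Rightarrow\Delta$; $\mathcal R,\Gamma\Rightarrow w:A,\Delta$ and $\mathcal R,\Gamma\Rightarrow w:B,\Delta/\mathcal R,\Gamma\Rightarrow w:A\land B,\Delta$; $\mathcal R,\Gamma,w:A\Rightarrow\Delta$ and $\mathcal R,\Gamma,w:B\Rightarrow\Delta/\mathcal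 R,\Gamma,w:A\lor B\Rightarrow\Delta$; $\mathcal R,\Gamma\Rightarrow w:A,w:B,\Delta/\mathcal R,\Gamma\Rightarrow w:A\lor B,\Delta$; $\mathcal R,\Gamma\Rightarrow w:A,\Delta$ and $\mathcal R,\Gamma,w:B\Rightarrow\Delta/\mathcal R,\Gamma,w:A\to B\Rightarrow\Delta$; $\mathcal R,\Gamma,w:A\Rightarrow w:B,\Delta/\mathcal R,\Gamma\Rightarrow w:A\to B,\Delta$; $\mathcal R,Rwu,\Gamma,u:A\Rightarrow\Delta/\mathcal R,\Gamma,w:\mathsf FA\Rightarrow\Delta$; $\mathcal R,Ruw,\Gamma,u:A\Rightarrow\Delta/\mathcal R,\Gamma,w:\mathsf PA\Rightarrow\Delta$; $\mathcal R,Rwu,\Gamma\Rightarrow u:A,\Delta/\mathcal R,\Gamma\Rightarrow w:\mathsf GA,\Delta$; $\mathcal R,Ruw,\Gamma\Rightarrow u:A,\Delta/\mathcal R,\Gamma\Rightarrow w:\mathsf HA,\Delta$ (in these four, $u$ does not occur in the conclusion); $\mathcal R,Rwu,\Gamma,w:\mathsf GA,u:A\Rightarrow\Delta/\mathcal R,Rwu,\Gamma,w:\mathsf GA\Rightarrow\Delta$; $\mathcal R,Ruw,\Gamma,w:\mathsf HA,u:A\Rightarrow\Delta/\mathcal R,Ruw,\Gamma,w:\mathsf HA\Rightarrow\Delta$; $\mathcal R,Rwu,\Gamma\Rightarrow w:\mathsf FA,u:A,\Delta/\mathcal R,Rwu,\Gamma\Rightarrow w:\mathsf FA,\Delta$;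 $\mathcal R,Ruw,\Gamma\Rightarrow w:\mathsf PA,u:A,\Delta/\mathcal R,Ruw,\Gamma\Rightarrow w:\mathsf PA,\Delta$. A labeled sequent $\mathcal R,\Gamma\Rightarrow\Delta$ is a labeled polytree sequent iff (1) if $\mathcal R=\emptyset$ then all labeled formulae in $\Gamma,\Delta$ carry one and the same label $w$; (2) if $\mathcal R\neq\emptyset$ then every label of a formula in $\Gamma,\Delta$ occurs in $\mathcal R$; (3) its graph (nodes: its labels; directed edges $(w,u)$ for $Rwu\in\mathcal R$) is connected and free of directed and undirected cycles. -}

module Defs where

open import Data.Nat using (ℕ)
open import Data.Product using (_×_; _,_; Σ; ∃; ∃-syntax)
open import Data.List using (List; []; _∷_; _++_; map; concatMap)
open import Data.List.Membership.Propositional using (_∈_; _∉_)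
open import Data.List.Relation.Unary.Unique.Propositional using (Unique)
open import Relation.Binary.PropositionalEquality using (_≡_; _≢_)
open import Relation.Nullary using (¬_)

data Formula : Set where
  atom : ℕ → Formula
  top  : Formula
  bot  : Formula
  neg  : Formula → Formula
  or   : Formula → Formula → Formula
  and  : Formula → Formula → Formula
  imp  : Formula → Formula → Formula
  G    : Formula → Formula
  F    : Formula → Formula
  H    : Formula → Formula
  P    : Formula → Formula

Label : Set
Label = ℕ

data LFormula : Set where
  _▸_ : Label → Formula → LFormula

label : LFormula → Label
label (w ▸ _) = w

-- Relational atom  R w u  is the pair (w , u).
RelAtom : Set
RelAtom = Label × Label

-- R is a finite set of relational atoms and
-- Γ, Δ finite multisets of labeled formulae; all are represented by lists
-- (order and multiplicity are irrelevant for everything below).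
record Sequent : Set where
  constructor seq
  field
    rel : List RelAtom
    ant : List LFormula
    suc : List LFormula
open Sequent public

relLabels : List RelAtom → List Label
relLabels = concatMap (λ { (a , b) → a ∷ b ∷ [] })

fmlLabels : Sequent → List Label
fmlLabels S = map label (ant S ++ suc S)

labels : Sequent → List Label
labels S = relLabels (rel S) ++ fmlLabels S

data UWalk (R : List RelAtom) : Label → Label → List RelAtom → Set where
  nil : ∀ {x} → UWalk R x x []
  fwd : ∀ {x z y es} → (x , z) ∈ R → UWalk R z y es → UWalk R x y ((x , z) ∷ es)
  bwd : ∀ {x z y es} → (z , x) ∈ R → UWalk R z y es → UWalk R x y ((z , x) ∷ es)

data DWalk (R : List RelAtom) : Label → Label → List RelAtom → Set where
  nil : ∀ {x} → DWalk R x x []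
  fwd : ∀ {x z y es} → (x , z) ∈ R → DWalk R z y es → DWalk R x y ((x , z) ∷ es)

DirectedCycle : List RelAtom → Set
DirectedCycle R = ∃[ x ] ∃[ es ] (DWalk R x x es × es ≢ [])

UndirectedCycle : List RelAtom → Set
UndirectedCycle R = ∃[ x ] ∃[ es ] (UWalk R x x es × es ≢ [] × Unique es)

Connected : Sequent → Set
Connected S = ∀ x y → x ∈ labels S → y ∈ labels S → ∃[ es ] UWalk (rel S) x y es

IsPolytree : Sequent → Set
IsPolytree S =
    (rel S ≡ [] → ∀ v w → v ∈ fmlLabels S → w ∈ fmlLabels S → v ≡ w)
  × (rel S ≢ [] → ∀ v → v ∈ fmlLabels S → v ∈ relLabels (rel S))
  × Connected S
  × ¬ DirectedCycle (rel S)
  × ¬ UndirectedCycle (rel S)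

data NonInitial : List Sequent → Sequent → Set where
  negL : ∀ {R Γ Δ w A} →
    NonInitial (seq R Γ (w ▸ A ∷ Δ) ∷ []) (seq R (w ▸ neg A ∷ Γ) Δ)
  negR : ∀ {R Γ Δ w A} →
    NonInitial (seq R (w ▸ A ∷ Γ) Δ ∷ []) (seq R Γ (w ▸ neg A ∷ Δ))
  andL : ∀ {R Γ Δ w A B} →
    NonInitial (seq R (w ▸ A ∷ w ▸ B ∷ Γ) Δ ∷ []) (seq R (w ▸ and A B ∷ Γ) Δ)
  andR : ∀ {R Γ Δ w A B} →
    NonInitial (seq R Γ (w ▸ A ∷ Δ) ∷ seq R Γ (w ▸ B ∷ Δ) ∷ [])
               (seq R Γ (w ▸ and A B ∷ Δ))
  orL : ∀ {R Γ Δ w A B} →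
    NonInitial (seq R (w ▸ A ∷ Γ) Δ ∷ seq R (w ▸ B ∷ Γ) Δ ∷ [])
               (seq R (w ▸ or A B ∷ Γ) Δ)
  orR : ∀ {R Γ Δ w A B} →
    NonInitial (seq R Γ (w ▸ A ∷ w ▸ B ∷ Δ) ∷ []) (seq R Γ (w ▸ or A B ∷ Δ))
  impL : ∀ {R Γ Δ w A B} →
    NonInitial (seq R Γ (w ▸ A ∷ Δ) ∷ seq R (w ▸ B ∷ Γ) Δ ∷ [])
               (seq R (w ▸ imp A B ∷ Γ) Δ)
  impR : ∀ {R Γ Δ w A B} →
    NonInitial (seq R (w ▸ A ∷ Γ) (w ▸ B ∷ Δ) ∷ []) (seq R Γ (w ▸ imp A B ∷ Δ))
  FL : ∀ {R Γ Δ w u A} → u ∉ labels (seq R (w ▸ F A ∷ Γ) Δ) →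
    NonInitial (seq ((w , u) ∷ R) (u ▸ A ∷ Γ) Δ ∷ []) (seq R (w ▸ F A ∷ Γ) Δ)
  PL : ∀ {R Γ Δ w u A} → u ∉ labels (seq R (w ▸ P A ∷ Γ) Δ) →
    NonInitial (seq ((u , w) ∷ R) (u ▸ A ∷ Γ) Δ ∷ []) (seq R (w ▸ P A ∷ Γ) Δ)
  GR : ∀ {R Γ Δ w u A} → u ∉ labels (seq R Γ (w ▸ G A ∷ Δ)) →
    NonInitial (seq ((w , u) ∷ R) Γ (u ▸ A ∷ Δ) ∷ []) (seq R Γ (w ▸ G A ∷ Δ))
  HR : ∀ {R Γ Δ w u A} → u ∉ labels (seq R Γ (w ▸ H A ∷ Δ)) →
    NonInitial (seq ((u , w) ∷ R) Γ (u ▸ A ∷ Δ) ∷ []) (seq R Γ (w ▸ H A ∷ Δ))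
  GL : ∀ {R Γ Δ w u A} →
    NonInitial (seq ((w , u) ∷ R) (w ▸ G A ∷ u ▸ A ∷ Γ) Δ ∷ [])
               (seq ((w , u) ∷ R) (w ▸ G A ∷ Γ) Δ)
  HL : ∀ {R Γ Δ w u A} →
    NonInitial (seq ((u , w) ∷ R) (w ▸ H A ∷ u ▸ A ∷ Γ) Δ ∷ [])
               (seq ((u , w) ∷ R) (w ▸ H A ∷ Γ) Δ)
  FR : ∀ {R Γ Δ w u A} →
    NonInitial (seq ((w , u) ∷ R) Γ (w ▸ F A ∷ u ▸ A ∷ Δ) ∷ [])
               (seq ((w , u) ∷ R) Γ (w ▸ F A ∷ Δ))
  PR : ∀ {R Γ Δ w u A} →
    NonInitial (seq ((u , w) ∷ R) Γ (w ▸ P A ∷ u ▸ A ∷ Δ) ∷ [])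
               (seq ((u , w) ∷ R) Γ (w ▸ P A ∷ Δ))

-- Being a polytree sequent depends on the relational atoms and, beyond them, only on the set
-- of formula labels: a formula may be moved across the sequent arrow, and a formula whose
-- label already occurs in the sequent may be added or removed. This settles every rule except
-- the four with an eigenvariable u, whose premise has the additional atom Rwu or Ruw. As u is
-- fresh, that atom is the only one at u, so neither a directed walk (it would use the atom
-- once into and once out of u) nor a trail (it would use it twice) can pass through u: cycles
-- of the premise are cycles of the conclusion. Contracting the atom, i.e. sending u to w,
-- turns connecting walks of the premise into connecting walks of the conclusion.
module Submission where

open import Defs
open import Data.List using (List)
open import Data.List.Relation.Unary.All using (All)
open import Function.Bundles using (_⇔_)

open import Data.Nat.Properties using (_≟_)
open import Data.List using ([]; _∷_; _++_; map)
open import Data.List.Relation.Unary.All using ([]; _∷_)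
import Data.List.Relation.Unary.All as All
open import Data.List.Relation.Unary.AllPairs using (_∷_)
open import Data.List.Relation.Unary.Any using (here; there)
open import Data.List.Relation.Unary.Unique.Propositional using (Unique)
open import Data.List.Membership.Propositional using (_∈_; _∉_)
open import Data.List.Membership.Propositional.Properties using (∈-++⁺ˡ; ∈-++⁺ʳ; ∈-++⁻)
open import Data.List.Relation.Binary.Subset.Propositional using (_⊆_)
open import Data.List.Relation.Binary.Permutation.Propositional using (_↭_; ↭-sym)
open import Data.List.Relation.Binary.Permutation.Propositional.Properties
  using (∈-resp-↭; map⁺; shift; ++⁺ˡ)
open import Data.Product using (_×_; _,_; ∃-syntax; proj₁; proj₂)
open import Data.Sum using (_⊎_; inj₁; inj₂; [_,_])
open import Data.Empty using (⊥; ⊥-elim)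
open import Function.Base using (id; _∘_)
open import Function.Bundles using (mk⇔; Equivalence)
open import Function.Construct.Identity using (⇔-id)
open import Function.Construct.Symmetry using (⇔-sym)
open import Relation.Nullary using (yes; no)
open import Function.Properties.Equivalence using (⇔-setoid)
open import Level using (0ℓ)
open import Relation.Binary.Reasoning.Setoid (⇔-setoid 0ℓ)
open import Relation.Binary.PropositionalEquality
  using (_≡_; _≢_; refl; sym; trans; cong; subst; subst₂)

private
  variable
    R : List RelAtom
    Γ Δ Γ′ Δ′ : List LFormula
    a b v w u x y z : Label
    e : RelAtom
    es fs : List RelAtom
    A B C : Formula
    φ : LFormula

∈-relLabelsˡ : (a , b) ∈ R → a ∈ relLabels R
∈-relLabelsˡ (here refl) = here refl
∈-relLabelsˡ {R = _ ∷ _} (there p) = there (there (∈-relLabelsˡ p))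

∈-relLabelsʳ : (a , b) ∈ R → b ∈ relLabels R
∈-relLabelsʳ (here refl) = there (here refl)
∈-relLabelsʳ {R = _ ∷ _} (there p) = there (there (∈-relLabelsʳ p))

relLabels-weaken : v ∈ relLabels R → v ∈ relLabels (e ∷ R)
relLabels-weaken {e = _ , _} = there ∘ there

relLabels-[] : R ≡ [] → v ∉ relLabels R
relLabels-[] refl ()

relLabels-nonempty : R ≢ [] → ∃[ a ] a ∈ relLabels R
relLabels-nonempty {R = []} R≢[] = ⊥-elim (R≢[] refl)
relLabels-nonempty {R = (a , _) ∷ _} _ = a , here refl

uwalk-weaken : UWalk R x y es → UWalk (e ∷ R) x y es
uwalk-weaken nil = nil
uwalk-weaken (fwd p r) = fwd (there p) (uwalk-weaken r)
uwalk-weaken (bwd p r) = bwd (there p) (uwalk-weaken r)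

dwalk-weaken : DWalk R x y es → DWalk (e ∷ R) x y es
dwalk-weaken nil = nil
dwalk-weaken (fwd p r) = fwd (there p) (dwalk-weaken r)

uwalk-++ : UWalk R x y es → UWalk R y z fs → UWalk R x z (es ++ fs)
uwalk-++ nil s = s
uwalk-++ (fwd p r) s = fwd p (uwalk-++ r s)
uwalk-++ (bwd p r) s = bwd p (uwalk-++ r s)

uwalk-relLabels : UWalk R x y es → x ∈ relLabels R → y ∈ relLabels R
uwalk-relLabels nil x∈ = x∈
uwalk-relLabels (fwd p r) _ = uwalk-relLabels r (∈-relLabelsʳ p)
uwalk-relLabels (bwd p r) _ = uwalk-relLabels r (∈-relLabelsˡ p)

dwalk-last : DWalk R x y es → x ≢ y → ∃[ a ] (a , y) ∈ R
dwalk-last nil x≢x = ⊥-elim (x≢x refl)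
dwalk-last {y = y} (fwd {z = z} p r) _ with z ≟ y
... | yes refl = _ , p
... | no z≢y = dwalk-last r z≢y

directedCycle-weaken : DirectedCycle R → DirectedCycle (e ∷ R)
directedCycle-weaken (x , es , cycle , es≢[]) = x , es , dwalk-weaken cycle , es≢[]

undirectedCycle-weaken : UndirectedCycle R → UndirectedCycle (e ∷ R)
undirectedCycle-weaken (x , es , cycle , es≢[] , unique) =
  x , es , uwalk-weaken cycle , es≢[] , unique

Joined : List RelAtom → Label → Label → Set
Joined R x y = ∃[ es ] UWalk R x y es

joined-trans : Joined R x y → Joined R y z → Joined R x z
joined-trans (_ , r) (_ , s) = _ , uwalk-++ r s

joined-sym : Joined R x y → Joined R y x
joined-sym (_ , nil) = _ , nil
joined-sym (_ , fwd p r) = joined-trans (joined-sym (_ , r)) (_ , bwd p nil)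
joined-sym (_ , bwd p r) = joined-trans (joined-sym (_ , r)) (_ , fwd p nil)

joined-weaken : Joined R x y → Joined (e ∷ R) x y
joined-weaken (_ , r) = _ , uwalk-weaken r

-- Polytree sequents only see formula labels

polytree-fmlLabel-cases : IsPolytree (seq R Γ Δ) → v ∈ fmlLabels (seq R Γ Δ) →
                    w ∈ fmlLabels (seq R Γ Δ) → v ≡ w ⊎ v ∈ relLabels R
polytree-fmlLabel-cases {R = []} (single , _) v∈ w∈ = inj₁ (single refl _ _ v∈ w∈)
polytree-fmlLabel-cases {R = _ ∷ _} (_ , fml⊆rel , _) v∈ _ = inj₂ (fml⊆rel (λ ()) _ v∈)

polytree-transfer : fmlLabels (seq R Γ Δ) ⊆ labels (seq R Γ′ Δ′) →
                    IsPolytree (seq R Γ′ Δ′) → IsPolytree (seq R Γ Δ)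
polytree-transfer {R = R} {Γ = Γ} {Δ = Δ} {Γ′ = Γ′} {Δ′ = Δ′} fml⊆
                  (single , fml⊆rel , connected , ¬dcycle , ¬ucycle) =
  single′ , fml⊆rel′ , connected′ , ¬dcycle , ¬ucycle
  where
  fml-cases : ∀ {v} → v ∈ fmlLabels (seq R Γ Δ) →
              v ∈ relLabels R ⊎ v ∈ fmlLabels (seq R Γ′ Δ′)
  fml-cases = ∈-++⁻ (relLabels R) ∘ fml⊆

  fml-[] : R ≡ [] → ∀ {v} → v ∈ fmlLabels (seq R Γ Δ) → v ∈ fmlLabels (seq R Γ′ Δ′)
  fml-[] R≡[] v∈ = [ ⊥-elim ∘ relLabels-[] R≡[] , id ] (fml-cases v∈)

  single′ : R ≡ [] → ∀ v v′ →
            v ∈ fmlLabels (seq R Γ Δ) → v′ ∈ fmlLabels (seq R Γ Δ) → v ≡ v′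
  single′ R≡[] v v′ v∈ v′∈ = single R≡[] v v′ (fml-[] R≡[] v∈) (fml-[] R≡[] v′∈)

  fml⊆rel′ : R ≢ [] → ∀ v → v ∈ fmlLabels (seq R Γ Δ) → v ∈ relLabels R
  fml⊆rel′ R≢[] v v∈ = [ id , fml⊆rel R≢[] v ] (fml-cases v∈)

  labels⊆ : labels (seq R Γ Δ) ⊆ labels (seq R Γ′ Δ′)
  labels⊆ v∈ = [ ∈-++⁺ˡ , fml⊆ ] (∈-++⁻ (relLabels R) v∈)

  connected′ : Connected (seq R Γ Δ)
  connected′ x y x∈ y∈ = connected x y (labels⊆ x∈) (labels⊆ y∈)

fmlLabels-shift : fmlLabels (seq R Γ (φ ∷ Δ)) ↭ fmlLabels (seq R (φ ∷ Γ) Δ)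
fmlLabels-shift {Γ = Γ} {φ = φ} {Δ = Δ} = map⁺ label (shift φ Γ Δ)

labels-shift : labels (seq R Γ (φ ∷ Δ)) ↭ labels (seq R (φ ∷ Γ) Δ)
labels-shift {R = R} = ++⁺ˡ (relLabels R) (fmlLabels-shift {R = R})

polytree-shift : IsPolytree (seq R Γ (φ ∷ Δ)) ⇔ IsPolytree (seq R (φ ∷ Γ) Δ)
polytree-shift {R = R} {Γ = Γ} {φ = φ} {Δ = Δ} = mk⇔
  (polytree-transfer {Γ = φ ∷ Γ} {Δ = Δ} {Γ′ = Γ} {Δ′ = φ ∷ Δ}
    (∈-++⁺ʳ (relLabels R) ∘ ∈-resp-↭ (↭-sym (fmlLabels-shift {R = R}))))
  (polytree-transfer {Γ = Γ} {Δ = φ ∷ Δ} {Γ′ = φ ∷ Γ} {Δ′ = Δ}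
    (∈-++⁺ʳ (relLabels R) ∘ ∈-resp-↭ (fmlLabels-shift {R = R})))

polytree-drop : label φ ∈ labels (seq R Γ Δ) →
                IsPolytree (seq R (φ ∷ Γ) Δ) ⇔ IsPolytree (seq R Γ Δ)
polytree-drop {φ = φ} {R = R} {Γ = Γ} {Δ = Δ} φ∈ = mk⇔
  (polytree-transfer {Γ = Γ} {Δ = Δ} {Γ′ = φ ∷ Γ} {Δ′ = Δ} (∈-++⁺ʳ (relLabels R) ∘ there))
  (polytree-transfer {Γ = φ ∷ Γ} {Δ = Δ} {Γ′ = Γ} {Δ′ = Δ} fml⊆)
  where
  fml⊆ : fmlLabels (seq R (φ ∷ Γ) Δ) ⊆ labels (seq R Γ Δ)
  fml⊆ (here refl) = φ∈
  fml⊆ (there v∈) = ∈-++⁺ʳ (relLabels R) v∈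

polytree-relabel-suc : IsPolytree (seq R Γ (w ▸ A ∷ Δ)) ⇔ IsPolytree (seq R Γ (w ▸ B ∷ Δ))
polytree-relabel-suc {R = R} {Γ = Γ} {w = w} {A = A} {Δ = Δ} {B = B} = begin
  IsPolytree (seq R Γ (w ▸ A ∷ Δ)) ≈⟨ polytree-shift ⟩
  IsPolytree (seq R (w ▸ B ∷ Γ) Δ) ≈⟨ polytree-shift ⟨
  IsPolytree (seq R Γ (w ▸ B ∷ Δ)) ∎

polytree-contract-ant :
  IsPolytree (seq R (w ▸ A ∷ w ▸ B ∷ Γ) Δ) ⇔ IsPolytree (seq R (w ▸ C ∷ Γ) Δ)
polytree-contract-ant {R = R} {w = w} {A = A} {B = B} {Γ = Γ} {Δ = Δ} =
  polytree-drop {φ = w ▸ A} {R = R} {Γ = w ▸ B ∷ Γ} {Δ = Δ} (∈-++⁺ʳ (relLabels R) (here refl))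

polytree-contract-suc :
  IsPolytree (seq R Γ (w ▸ A ∷ w ▸ B ∷ Δ)) ⇔ IsPolytree (seq R Γ (w ▸ C ∷ Δ))
polytree-contract-suc {R = R} {Γ = Γ} {w = w} {A = A} {B = B} {Δ = Δ} {C = C} = begin
  IsPolytree (seq R Γ (w ▸ A ∷ w ▸ B ∷ Δ))   ≈⟨ polytree-shift ⟩
  IsPolytree (seq R (w ▸ A ∷ Γ) (w ▸ B ∷ Δ)) ≈⟨ polytree-shift {Γ = w ▸ A ∷ Γ} ⟩
  IsPolytree (seq R (w ▸ B ∷ w ▸ A ∷ Γ) Δ)
    ≈⟨ polytree-contract-ant {A = B} {B = A} {Γ = Γ} {Δ = Δ} {C = C} ⟩
  IsPolytree (seq R (w ▸ C ∷ Γ) Δ)           ≈⟨ polytree-shift ⟨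
  IsPolytree (seq R Γ (w ▸ C ∷ Δ))           ∎

polytree-contract-across :
  IsPolytree (seq R (w ▸ A ∷ Γ) (w ▸ B ∷ Δ)) ⇔ IsPolytree (seq R Γ (w ▸ C ∷ Δ))
polytree-contract-across {R = R} {w = w} {A = A} {Γ = Γ} {B = B} {Δ = Δ} {C = C} = begin
  IsPolytree (seq R (w ▸ A ∷ Γ) (w ▸ B ∷ Δ)) ≈⟨ polytree-shift {Γ = w ▸ A ∷ Γ} ⟩
  IsPolytree (seq R (w ▸ B ∷ w ▸ A ∷ Γ) Δ)
    ≈⟨ polytree-contract-ant {A = B} {B = A} {Γ = Γ} {Δ = Δ} {C = C} ⟩
  IsPolytree (seq R (w ▸ C ∷ Γ) Δ)           ≈⟨ polytree-shift ⟨
  IsPolytree (seq R Γ (w ▸ C ∷ Δ))           ∎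

polytree-drop-related-ant : u ∈ relLabels R →
  IsPolytree (seq R (φ ∷ u ▸ A ∷ Γ) Δ) ⇔ IsPolytree (seq R (φ ∷ Γ) Δ)
polytree-drop-related-ant {u = u} {R = R} {φ = φ} {A = A} {Γ = Γ} {Δ = Δ} u∈R = begin
  IsPolytree (seq R (φ ∷ u ▸ A ∷ Γ) Δ)   ≈⟨ polytree-shift {Γ = u ▸ A ∷ Γ} ⟨
  IsPolytree (seq R (u ▸ A ∷ Γ) (φ ∷ Δ))
    ≈⟨ polytree-drop {φ = u ▸ A} {Γ = Γ} {Δ = φ ∷ Δ} (∈-++⁺ˡ u∈R) ⟩
  IsPolytree (seq R Γ (φ ∷ Δ))           ≈⟨ polytree-shift ⟩
  IsPolytree (seq R (φ ∷ Γ) Δ)           ∎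

polytree-drop-related-suc : u ∈ relLabels R →
  IsPolytree (seq R Γ (φ ∷ u ▸ A ∷ Δ)) ⇔ IsPolytree (seq R Γ (φ ∷ Δ))
polytree-drop-related-suc {u = u} {R = R} {Γ = Γ} {φ = φ} {A = A} {Δ = Δ} u∈R = begin
  IsPolytree (seq R Γ (φ ∷ u ▸ A ∷ Δ))   ≈⟨ polytree-shift ⟩
  IsPolytree (seq R (φ ∷ Γ) (u ▸ A ∷ Δ)) ≈⟨ polytree-shift {Γ = φ ∷ Γ} ⟩
  IsPolytree (seq R (u ▸ A ∷ φ ∷ Γ) Δ)
    ≈⟨ polytree-drop {φ = u ▸ A} {Γ = φ ∷ Γ} {Δ = Δ} (∈-++⁺ˡ u∈R) ⟩
  IsPolytree (seq R (φ ∷ Γ) Δ)           ≈⟨ polytree-shift ⟨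
  IsPolytree (seq R Γ (φ ∷ Δ))           ∎

-- Attaching a fresh leaf

data EdgeBetween (w u : Label) : RelAtom → Set where
  outgoing : EdgeBetween w u (w , u)
  incoming : EdgeBetween w u (u , w)

edge-ends : EdgeBetween w u e → (a , b) ≡ e → (a ≡ w × b ≡ u) ⊎ (a ≡ u × b ≡ w)
edge-ends outgoing refl = inj₁ (refl , refl)
edge-ends incoming refl = inj₂ (refl , refl)

edge-one-way : EdgeBetween w u e → (a , u) ≡ e → (u , b) ≡ e → w ≡ u
edge-one-way outgoing refl eq = sym (cong proj₁ eq)
edge-one-way incoming eq refl = sym (cong proj₂ eq)

edge-relLabels : EdgeBetween w u e → v ∈ relLabels (e ∷ R) → v ≡ w ⊎ v ≡ u ⊎ v ∈ relLabels R
edge-relLabels outgoing (here v≡w) = inj₁ v≡w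
edge-relLabels outgoing (there (here v≡u)) = inj₂ (inj₁ v≡u)
edge-relLabels incoming (here v≡u) = inj₂ (inj₁ v≡u)
edge-relLabels incoming (there (here v≡w)) = inj₁ v≡w
edge-relLabels outgoing (there (there v∈)) = inj₂ (inj₂ v∈)
edge-relLabels incoming (there (there v∈)) = inj₂ (inj₂ v∈)

edge-w∈ : EdgeBetween w u e → w ∈ relLabels (e ∷ R)
edge-w∈ outgoing = here refl
edge-w∈ incoming = there (here refl)

edge-u∈ : EdgeBetween w u e → u ∈ relLabels (e ∷ R)
edge-u∈ outgoing = there (here refl)
edge-u∈ incoming = here refl

edge-joined : EdgeBetween w u e → Joined (e ∷ R) u w
edge-joined outgoing = _ , bwd (here refl) nil
edge-joined incoming = _ , fwd (here refl) nil

module FreshLeaf {w u : Label} {e : RelAtom} (edge : EdgeBetween w u e)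
                 {R : List RelAtom} (u∉R : u ∉ relLabels R) (w≢u : w ≢ u) where

  relLabel-≢u : v ∈ relLabels R → v ≢ u
  relLabel-≢u v∈ refl = u∉R v∈

  w∈e∷R : w ∈ relLabels (e ∷ R)
  w∈e∷R = edge-w∈ {R = R} edge

  u∈e∷R : u ∈ relLabels (e ∷ R)
  u∈e∷R = edge-u∈ {R = R} edge

  R⊆e∷R : relLabels R ⊆ relLabels (e ∷ R)
  R⊆e∷R = relLabels-weaken {R = R} {e = e}

  e∷R-cases : ∀ {v} → v ∈ relLabels (e ∷ R) → v ≡ w ⊎ v ≡ u ⊎ v ∈ relLabels R
  e∷R-cases = edge-relLabels {R = R} edge

  at-u : (a , b) ∈ e ∷ R → a ≡ u ⊎ b ≡ u → (a , b) ≡ e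
  at-u (here eq) _ = eq
  at-u (there p) (inj₁ a≡u) = ⊥-elim (relLabel-≢u (∈-relLabelsˡ p) a≡u)
  at-u (there p) (inj₂ b≡u) = ⊥-elim (relLabel-≢u (∈-relLabelsʳ p) b≡u)

  away-from-u : (a , b) ∈ e ∷ R → a ≢ u → b ≢ u → (a , b) ∈ R
  away-from-u (here eq) a≢u b≢u with edge-ends edge eq
  ... | inj₁ (_ , b≡u) = ⊥-elim (b≢u b≡u)
  ... | inj₂ (a≡u , _) = ⊥-elim (a≢u a≡u)
  away-from-u (there p) _ _ = p

  u-not-through : (a , u) ∈ e ∷ R → (u , b) ∈ e ∷ R → ⊥
  u-not-through p q = w≢u (edge-one-way edge (at-u p (inj₂ refl)) (at-u q (inj₁ refl)))

  dwalk-restrict : DWalk (e ∷ R) x y es → x ≢ u → y ≢ u → DWalk R x y es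
  dwalk-restrict nil _ _ = nil
  dwalk-restrict (fwd {z = z} p r) x≢u y≢u with z ≟ u
  ... | no z≢u = fwd (away-from-u p x≢u z≢u) (dwalk-restrict r z≢u y≢u)
  ... | yes refl with r
  ...   | nil = ⊥-elim (y≢u refl)
  ...   | fwd q _ = ⊥-elim (u-not-through p q)

  no-closed-dwalk-at-u : DWalk (e ∷ R) u u ((a , b) ∷ es) → ⊥
  no-closed-dwalk-at-u (fwd {z = z} p r) with z ≟ u
  ... | yes refl = u-not-through p p
  ... | no z≢u = u-not-through (proj₂ (dwalk-last r z≢u)) p

  directedCycle-restrict : DirectedCycle (e ∷ R) → DirectedCycle R
  directedCycle-restrict (_ , [] , _ , es≢[]) = ⊥-elim (es≢[] refl)
  directedCycle-restrict (x , es@(_ ∷ _) , cycle , es≢[]) with x ≟ u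
  ... | no x≢u = x , es , dwalk-restrict cycle x≢u x≢u , es≢[]
  ... | yes refl = ⊥-elim (no-closed-dwalk-at-u cycle)

  leaves-u-by-e : UWalk (e ∷ R) u y es → y ≢ u → e ∈ es
  leaves-u-by-e nil y≢u = ⊥-elim (y≢u refl)
  leaves-u-by-e (fwd p _) _ = here (sym (at-u p (inj₁ refl)))
  leaves-u-by-e (bwd p _) _ = here (sym (at-u p (inj₂ refl)))

  enters-u-by-e : UWalk (e ∷ R) x u es → x ≢ u → e ∈ es
  enters-u-by-e nil x≢u = ⊥-elim (x≢u refl)
  enters-u-by-e (fwd {z = z} p r) _ with z ≟ u
  ... | yes refl = here (sym (at-u p (inj₂ refl)))
  ... | no z≢u = there (enters-u-by-e r z≢u)
  enters-u-by-e (bwd {z = z} p r) _ with z ≟ u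
  ... | yes refl = here (sym (at-u p (inj₁ refl)))
  ... | no z≢u = there (enters-u-by-e r z≢u)

  trail-restrict : UWalk (e ∷ R) x y es → Unique es → x ≢ u → y ≢ u → UWalk R x y es
  trail-restrict nil _ _ _ = nil
  trail-restrict (fwd {z = z} p r) (distinct ∷ unique) x≢u y≢u with z ≟ u
  ... | no z≢u = fwd (away-from-u p x≢u z≢u) (trail-restrict r unique z≢u y≢u)
  ... | yes refl = ⊥-elim (All.lookup distinct (leaves-u-by-e r y≢u) (at-u p (inj₂ refl)))
  trail-restrict (bwd {z = z} p r) (distinct ∷ unique) x≢u y≢u with z ≟ u
  ... | no z≢u = bwd (away-from-u p z≢u x≢u) (trail-restrict r unique z≢u y≢u)
  ... | yes refl = ⊥-elim (All.lookup distinct (leaves-u-by-e r y≢u) (at-u p (inj₁ refl)))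

  no-closed-trail-at-u : UWalk (e ∷ R) u u ((a , b) ∷ es) → Unique ((a , b) ∷ es) → ⊥
  no-closed-trail-at-u (fwd {z = z} p r) (distinct ∷ _) with z ≟ u
  ... | yes refl = u-not-through p p
  ... | no z≢u = All.lookup distinct (enters-u-by-e r z≢u) (at-u p (inj₁ refl))
  no-closed-trail-at-u (bwd {z = z} p r) (distinct ∷ _) with z ≟ u
  ... | yes refl = u-not-through p p
  ... | no z≢u = All.lookup distinct (enters-u-by-e r z≢u) (at-u p (inj₂ refl))

  undirectedCycle-restrict : UndirectedCycle (e ∷ R) → UndirectedCycle R
  undirectedCycle-restrict (_ , [] , _ , es≢[] , _) = ⊥-elim (es≢[] refl)
  undirectedCycle-restrict (x , es@(_ ∷ _) , cycle , es≢[] , unique) with x ≟ u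
  ... | no x≢u = x , es , trail-restrict cycle unique x≢u x≢u , es≢[] , unique
  ... | yes refl = ⊥-elim (no-closed-trail-at-u cycle unique)

  collapse : Label → Label
  collapse v with v ≟ u
  ... | yes _ = w
  ... | no _ = v

  collapse-u : collapse u ≡ w
  collapse-u with u ≟ u
  ... | yes _ = refl
  ... | no u≢u = ⊥-elim (u≢u refl)

  collapse-≢ : v ≢ u → collapse v ≡ v
  collapse-≢ {v} v≢u with v ≟ u
  ... | yes v≡u = ⊥-elim (v≢u v≡u)
  ... | no _ = refl

  collapse-step : (a , b) ∈ e ∷ R → collapse a ≡ collapse b ⊎ (collapse a , collapse b) ∈ R
  collapse-step (here eq) with edge-ends edge eq
  ... | inj₁ (refl , refl) = inj₁ (trans (collapse-≢ w≢u) (sym collapse-u))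
  ... | inj₂ (refl , refl) = inj₁ (trans collapse-u (sym (collapse-≢ w≢u)))
  collapse-step (there p) = inj₂ (subst₂ (λ a′ b′ → (a′ , b′) ∈ R)
    (sym (collapse-≢ (relLabel-≢u (∈-relLabelsˡ p))))
    (sym (collapse-≢ (relLabel-≢u (∈-relLabelsʳ p)))) p)

  joined-collapse : UWalk (e ∷ R) x y es → Joined R (collapse x) (collapse y)
  joined-collapse nil = _ , nil
  joined-collapse (fwd p r) with collapse-step p
  ... | inj₁ eq = subst (λ v → Joined R v _) (sym eq) (joined-collapse r)
  ... | inj₂ q = joined-trans (_ , fwd q nil) (joined-collapse r)
  joined-collapse (bwd p r) with collapse-step p
  ... | inj₁ eq = subst (λ v → Joined R v _) eq (joined-collapse r)
  ... | inj₂ q = joined-trans (_ , bwd q nil) (joined-collapse r)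

polytree-attach-leaf-ant : EdgeBetween w u e → u ∉ labels (seq R (w ▸ A ∷ Γ) Δ) →
  IsPolytree (seq (e ∷ R) (u ▸ B ∷ Γ) Δ) ⇔ IsPolytree (seq R (w ▸ A ∷ Γ) Δ)
polytree-attach-leaf-ant {w = w} {u = u} {e = e} {R = R} {A = A} {Γ = Γ} {Δ = Δ} {B = B} edge fresh =
  mk⇔ restrict extend
  where
  premise conclusion : Sequent
  premise = seq (e ∷ R) (u ▸ B ∷ Γ) Δ
  conclusion = seq R (w ▸ A ∷ Γ) Δ

  ≢u : ∀ {v} → v ∈ labels conclusion → v ≢ u
  ≢u v∈ refl = fresh v∈

  w∈C : w ∈ labels conclusion
  w∈C = ∈-++⁺ʳ (relLabels R) (here refl)

  open FreshLeaf edge {R} (fresh ∘ ∈-++⁺ˡ) (≢u w∈C)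

  labels-P : ∀ {v} → v ∈ labels premise → v ≡ u ⊎ v ∈ labels conclusion
  labels-P v∈ with ∈-++⁻ (relLabels (e ∷ R)) v∈
  ... | inj₂ (here v≡u) = inj₁ v≡u
  ... | inj₂ (there v∈) = inj₂ (∈-++⁺ʳ (relLabels R) (there v∈))
  ... | inj₁ v∈ with e∷R-cases v∈
  ...   | inj₁ refl = inj₂ w∈C
  ...   | inj₂ (inj₁ v≡u) = inj₁ v≡u
  ...   | inj₂ (inj₂ v∈R) = inj₂ (∈-++⁺ˡ v∈R)

  labels-C : ∀ {v} → v ∈ labels conclusion → v ∈ labels premise
  labels-C v∈ with ∈-++⁻ (relLabels R) v∈
  ... | inj₁ v∈R = ∈-++⁺ˡ (R⊆e∷R v∈R)
  ... | inj₂ (here refl) = ∈-++⁺ˡ w∈e∷R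
  ... | inj₂ (there v∈) = ∈-++⁺ʳ (relLabels (e ∷ R)) (there v∈)

  extend : IsPolytree conclusion → IsPolytree premise
  extend C-tree@(_ , _ , connected , ¬dcycle , ¬ucycle) =
    (λ ()) , fml⊆rel , connected′ ,
    ¬dcycle ∘ directedCycle-restrict , ¬ucycle ∘ undirectedCycle-restrict
    where
    fml⊆rel : e ∷ R ≢ [] → ∀ v → v ∈ fmlLabels premise → v ∈ relLabels (e ∷ R)
    fml⊆rel _ _ (here refl) = u∈e∷R
    fml⊆rel _ _ (there v∈)
      with polytree-fmlLabel-cases {Γ = w ▸ A ∷ Γ} {w = w} C-tree (there v∈) (here refl)
    ... | inj₁ refl = w∈e∷R
    ... | inj₂ v∈R = R⊆e∷R v∈R

    joined-w : ∀ {v} → v ≡ u ⊎ v ∈ labels conclusion → Joined (e ∷ R) v w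
    joined-w (inj₁ refl) = edge-joined edge
    joined-w (inj₂ v∈) = joined-weaken (connected _ w v∈ w∈C)

    connected′ : Connected premise
    connected′ x y x∈ y∈ =
      joined-trans (joined-w (labels-P x∈)) (joined-sym (joined-w (labels-P y∈)))

  restrict : IsPolytree premise → IsPolytree conclusion
  restrict (_ , fml⊆rel , connected , ¬dcycle , ¬ucycle) =
    single′ , fml⊆rel′ , joined-C ,
    ¬dcycle ∘ directedCycle-weaken , ¬ucycle ∘ undirectedCycle-weaken
    where
    fml-cases : ∀ {v} → v ∈ fmlLabels conclusion → v ≡ w ⊎ v ∈ relLabels R
    fml-cases (here refl) = inj₁ refl
    fml-cases {v} (there v∈) with e∷R-cases (fml⊆rel (λ ()) v (there v∈))
    ... | inj₁ v≡w = inj₁ v≡w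
    ... | inj₂ (inj₁ v≡u) = ⊥-elim (≢u (∈-++⁺ʳ (relLabels R) (there v∈)) v≡u)
    ... | inj₂ (inj₂ v∈R) = inj₂ v∈R

    is-w : R ≡ [] → ∀ {v} → v ∈ fmlLabels conclusion → v ≡ w
    is-w R≡[] v∈ = [ id , ⊥-elim ∘ relLabels-[] R≡[] ] (fml-cases v∈)

    single′ : R ≡ [] → ∀ v v′ →
              v ∈ fmlLabels conclusion → v′ ∈ fmlLabels conclusion → v ≡ v′
    single′ R≡[] _ _ v∈ v′∈ = trans (is-w R≡[] v∈) (sym (is-w R≡[] v′∈))

    joined-C : ∀ x y → x ∈ labels conclusion → y ∈ labels conclusion → Joined R x y
    joined-C x y x∈ y∈ = subst₂ (Joined R) (collapse-≢ (≢u x∈)) (collapse-≢ (≢u y∈))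
      (joined-collapse (proj₂ (connected x y (labels-C x∈) (labels-C y∈))))

    w∈R : R ≢ [] → w ∈ relLabels R
    w∈R R≢[] with relLabels-nonempty R≢[]
    ... | a , a∈R = uwalk-relLabels (proj₂ (joined-C a w (∈-++⁺ˡ a∈R) w∈C)) a∈R

    fml⊆rel′ : R ≢ [] → ∀ v → v ∈ fmlLabels conclusion → v ∈ relLabels R
    fml⊆rel′ R≢[] v v∈ =
      [ (λ v≡w → subst (_∈ relLabels R) (sym v≡w) (w∈R R≢[])) , id ] (fml-cases v∈)

polytree-attach-leaf-suc : EdgeBetween w u e → u ∉ labels (seq R Γ (w ▸ A ∷ Δ)) →
  IsPolytree (seq (e ∷ R) Γ (u ▸ B ∷ Δ)) ⇔ IsPolytree (seq R Γ (w ▸ A ∷ Δ))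
polytree-attach-leaf-suc {w = w} {u = u} {e = e} {R = R} {Γ = Γ} {A = A} {Δ = Δ} {B = B} edge fresh =
  begin
  IsPolytree (seq (e ∷ R) Γ (u ▸ B ∷ Δ)) ≈⟨ polytree-shift ⟩
  IsPolytree (seq (e ∷ R) (u ▸ B ∷ Γ) Δ)
    ≈⟨ polytree-attach-leaf-ant {A = A} {Γ = Γ} {Δ = Δ} {B = B} edge fresh′ ⟩
  IsPolytree (seq R (w ▸ A ∷ Γ) Δ)       ≈⟨ polytree-shift ⟨
  IsPolytree (seq R Γ (w ▸ A ∷ Δ))       ∎
  where
  fresh′ : u ∉ labels (seq R (w ▸ A ∷ Γ) Δ)
  fresh′ = fresh ∘ ∈-resp-↭ (↭-sym (labels-shift {R = R} {Γ = Γ} {φ = w ▸ A} {Δ = Δ}))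

All-⇔ : ∀ {I : Set} {Q : I → Set} {X : Set} {is} →
        All (λ i → Q i ⇔ X) is → is ≢ [] → All Q is ⇔ X
All-⇔ [] []≢[] = ⊥-elim ([]≢[] refl)
All-⇔ Qs⇔X@(Q⇔X ∷ _) _ = mk⇔ (λ { (q ∷ _) → Equivalence.to Q⇔X q })
                               (λ x → All.map (λ i⇔X → Equivalence.from i⇔X x) Qs⇔X)

premises-nonempty : ∀ {premises conclusion} → NonInitial premises conclusion → premises ≢ []
premises-nonempty () refl

-- IsPolytree sees formulae only through their labels, so a sequent whose antecedent starts
-- with a given formula cannot be recovered by unification; there the arguments are explicit.
premise⇔conclusion : ∀ {premises conclusion} → NonInitial premises conclusion →
                     All (λ S → IsPolytree S ⇔ IsPolytree conclusion) premises
premise⇔conclusion negL = polytree-shift ∷ []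
premise⇔conclusion negR = ⇔-sym polytree-shift ∷ []
premise⇔conclusion (andL {Γ = Γ} {Δ} {A = A} {B}) =
  polytree-contract-ant {A = A} {B = B} {Γ = Γ} {Δ = Δ} {C = and A B} ∷ []
premise⇔conclusion andR = polytree-relabel-suc ∷ polytree-relabel-suc ∷ []
premise⇔conclusion orL = ⇔-id _ ∷ ⇔-id _ ∷ []
premise⇔conclusion orR = polytree-contract-suc ∷ []
premise⇔conclusion impL = polytree-shift ∷ ⇔-id _ ∷ []
premise⇔conclusion (impR {Γ = Γ} {Δ} {A = A} {B}) =
  polytree-contract-across {A = A} {Γ = Γ} {B = B} {Δ = Δ} {C = imp A B} ∷ []
premise⇔conclusion (FL {Γ = Γ} {Δ} {A = A} fresh) =
  polytree-attach-leaf-ant {A = F A} {Γ = Γ} {Δ = Δ} {B = A} outgoing fresh ∷ []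
premise⇔conclusion (PL {Γ = Γ} {Δ} {A = A} fresh) =
  polytree-attach-leaf-ant {A = P A} {Γ = Γ} {Δ = Δ} {B = A} incoming fresh ∷ []
premise⇔conclusion (GR fresh) = polytree-attach-leaf-suc outgoing fresh ∷ []
premise⇔conclusion (HR fresh) = polytree-attach-leaf-suc incoming fresh ∷ []
premise⇔conclusion (GL {Γ = Γ} {Δ} {w} {A = A}) =
  polytree-drop-related-ant {φ = w ▸ G A} {A = A} {Γ = Γ} {Δ = Δ} (there (here refl)) ∷ []
premise⇔conclusion (HL {Γ = Γ} {Δ} {w} {A = A}) =
  polytree-drop-related-ant {φ = w ▸ H A} {A = A} {Γ = Γ} {Δ = Δ} (here refl) ∷ []
premise⇔conclusion FR = polytree-drop-related-suc (there (here refl)) ∷ []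
premise⇔conclusion PR = polytree-drop-related-suc (here refl) ∷ []

proposition3 : ∀ {premises : List Sequent} {conclusion : Sequent} →
    NonInitial premises conclusion →
    (All IsPolytree premises ⇔ IsPolytree conclusion)
proposition3 rule = All-⇔ (premise⇔conclusion rule) (premises-nonempty rule)
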